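{- Let $n\geq 3$ and let $G=K_{2,n}$ with bipartition $\{x_1,x_2\}$, $\{y_1,\dots,y_n\}$. If $L$ is an $m$-assignment for $G$ with $m\geq 3$, $|L(x_1)\cap L(x_2)|=m-1$, and $L(y_j)\subseteq L(x_1)\cup L(x_2)$ for all $j\in[n]$, then $P(G,L)\geq P(G,m)=m(m-1)^n+m(m-1)(m-2)^n$.
   Context: A list assignment $L$ for a graph $G$ assigns to each vertex $v$ a set $L(v)$ of colors; it is an $m$-assignment if $|L(v)|=m$ for all $v$. $P(G,L)$ is the number of proper colorings $f$ of $G$ with $f(v)\in L(v)$ for all $v$. $P(G,m)$ is the chromatic polynomial of $G$. $[n]=\{1,\dots,n\}$. -}

module Defs where

open import Data.Nat using (ℕ; zero; suc; _≡ᵇ_)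
open import Data.Bool using (Bool; true; false; not; _∧_; _∨_)
open import Data.Fin using (Fin; zero; suc)
open import Data.List using (List; []; _∷_; map; concatMap; length; filterᵇ; upTo; allFin)
open import Data.Bool.ListAction using (all)
open import Data.Vec using (Vec; []; _∷_; lookup)

record Graph (k : ℕ) : Set where
  field
    adj : Fin k → Fin k → Bool
open Graph public

-- A list assignment: each vertex gets a list of colours (colours are natural
-- numbers); set-hood and size are imposed separately (Unique, length).
ListAssignment : ℕ → Set
ListAssignment k = Fin k → List ℕ

-- All choice functions f with f(v) ∈ L(v), as vectors indexed by vertices.
-- (When each L(v) is duplicate-free, each such f appears exactly once.)
choices : (k : ℕ) → ListAssignment k → List (Vec ℕ k)
choices zero    L = [] ∷ []
choices (suc k) L =
  concatMap (λ c → map (c ∷_) (choices k (λ i → L (suc i)))) (L zero)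

isProper : {k : ℕ} → Graph k → Vec ℕ k → Bool
isProper {k} G f =
  all (λ i → all (λ j → not (adj G i j) ∨ not (lookup f i ≡ᵇ lookup f j)) (allFin k)) (allFin k)

P-list : {k : ℕ} → Graph k → ListAssignment k → ℕ
P-list {k} G L = length (filterᵇ (isProper G) (choices k L))

P-chrom : {k : ℕ} → Graph k → ℕ → ℕ
P-chrom G m = P-list G (λ _ → upTo m)

x₁ x₂ : {n : ℕ} → Fin (2 Data.Nat.+ n)
x₁ = zero
x₂ = suc zero

y : {n : ℕ} → Fin n → Fin (2 Data.Nat.+ n)
y j = suc (suc j)

K2 : (n : ℕ) → Graph (2 Data.Nat.+ n)
K2 n = record { adj = a }
  where
  a : Fin (2 Data.Nat.+ n) → Fin (2 Data.Nat.+ n) → Bool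
  a zero          (suc (suc _)) = true
  a (suc zero)    (suc (suc _)) = true
  a (suc (suc _)) zero          = true
  a (suc (suc _)) (suc zero)    = true
  a _             _             = false

-- Colouring x₁ and x₂ by c₁ and c₂ leaves each yⱼ the colours of L(yⱼ) ∖ {c₁, c₂}, so
-- P(K₂,ₙ, L) = Σ_{c₁ ∈ L(x₁)} Σ_{c₂ ∈ L(x₂)} Πⱼ |L(yⱼ) ∖ {c₁, c₂}|; for L ≡ {0, …, m − 1} this
-- evaluates to the chromatic polynomial. In general L(x₁) = A ∪ {a} and L(x₂) = A ∪ {b} with
-- |A| = m − 1. Every term is at least (m − 2)ⁿ. In each row c₁ keep one term, (c, c) for c ∈ A
-- and (a, b) for c₁ = a, and bound the m − 1 others by (m − 2)ⁿ. The factors of a kept term are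
-- at least m − 1 (at least m − 2 for (a, b)), and since a, b and A are m + 1 distinct colours,
-- every L(yⱼ) misses one of them: in each column j the (a, b)-factor is m − 1 or some
-- (c, c)-factor is m. An induction on n shows that the kept terms then sum to at least m(m − 1)ⁿ.
{-# OPTIONS --safe #-}
module Submission where

open import Defs
open import Data.Nat using (ℕ; _+_; _*_; _∸_; _^_; _≤_; _≥_)
open import Data.Fin using (Fin)
open import Data.List using (List; length; filter)
open import Data.List.Membership.Propositional using (_∈_)
open import Data.List.Membership.DecPropositional Data.Nat._≟_ using (_∈?_)
open import Data.List.Relation.Unary.Unique.Propositional using (Unique)
open import Data.Sum using (_⊎_)
open import Data.Product using (_×_)
open import Relation.Binary.PropositionalEquality using (_≡_)

open import Data.Bool using (Bool; true; false; not; _∧_; _∨_; T)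
open import Data.Bool.ListAction using (all)
open import Data.Bool.Properties using (∧-zeroʳ; ∧-identityʳ)
open import Data.Empty using (⊥-elim)
open import Data.Fin using (zero; suc)
open import Data.List using ([]; _∷_; _++_; map; concatMap; filterᵇ; upTo; allFin; tabulate)
open import Data.List.Properties
  using (length-++; filter-++; filter-none; filter-≐; filter-notAll; length-removeAt; length-removeAt′; length-upTo)
open import Data.List.Membership.Propositional using (_∉_; _─_; find)
open import Data.List.Membership.Propositional.Properties using (∈-filter⁻; ∈-filter⁺)
open import Data.List.Relation.Unary.All as All using (all?; []; _∷_)
open import Data.List.Relation.Unary.All.Properties using (¬All⇒Any¬)
open import Data.List.Relation.Unary.AllPairs using ([]; _∷_)
open import Data.List.Relation.Unary.Any as Any using (here; there)
import Data.List.Relation.Unary.Unique.Propositional.Properties as Unique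
open import Data.Nat using (zero; suc; _<_; _≡ᵇ_; z≤n; s≤s; _≟_)
open import Data.Nat.Properties
open import Data.Nat.Tactic.RingSolver using (solve-∀)
open import Algebra.Properties.CommutativeSemigroup +-commutativeSemigroup
  using () renaming (interchange to +-interchange; x∙yz≈y∙xz to +-left-comm; xy∙z≈xz∙y to +-right-comm)
open import Algebra.Properties.CommutativeSemigroup *-commutativeSemigroup
  using () renaming (x∙yz≈y∙xz to *-left-comm)
open import Data.Product using (∃-syntax; _,_; proj₁; proj₂; uncurry)
open import Data.Sum using (inj₁; inj₂; [_,_]′)
open import Data.Vec using (Vec; _∷_; lookup)
open import Function using (_∘_; id)
open import Relation.Binary.PropositionalEquality using (_≢_; refl; sym; trans; cong; cong₂; subst; ≢-sym; module ≡-Reasoning)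
open import Relation.Nullary using (¬_; yes; no; ¬?; contradiction)
open import Relation.Nullary.Decidable using (T?)
open import Relation.Unary using (Pred; Decidable)
open import Relation.Unary.Properties using (∁?)
open import Level using (0ℓ)

∑ : {A : Set} → List A → (A → ℕ) → ℕ
∑ []       f = 0
∑ (x ∷ xs) f = f x + ∑ xs f

syntax ∑ xs (λ x → e) = ∑[ x ∈ xs ] e

∏ : (n : ℕ) → (Fin n → ℕ) → ℕ
∏ zero    f = 1
∏ (suc n) f = f zero * ∏ n (f ∘ suc)

syntax ∏ n (λ j → e) = ∏[ j < n ] e

⋀ : (n : ℕ) → (Fin n → Bool) → Bool
⋀ zero    p = true
⋀ (suc n) p = p zero ∧ ⋀ n (p ∘ suc)

syntax ⋀ n (λ j → e) = ⋀[ j < n ] e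

module _ {A : Set} where

  ∑-cong : ∀ xs {f g : A → ℕ} → (∀ x → f x ≡ g x) → ∑ xs f ≡ ∑ xs g
  ∑-cong []       f≗g = refl
  ∑-cong (x ∷ xs) f≗g = cong₂ _+_ (f≗g x) (∑-cong xs f≗g)

  ∑-mono-≤ : ∀ xs {f g : A → ℕ} → (∀ {x} → x ∈ xs → f x ≤ g x) → ∑ xs f ≤ ∑ xs g
  ∑-mono-≤ []       f≤g = z≤n
  ∑-mono-≤ (x ∷ xs) f≤g = +-mono-≤ (f≤g (here refl)) (∑-mono-≤ xs (f≤g ∘ there))

  ∑-const : ∀ {xs} {f : A → ℕ} {v} → (∀ {x} → x ∈ xs → f x ≡ v) → ∑ xs f ≡ length xs * v
  ∑-const {[]}     f≡v = refl
  ∑-const {x ∷ xs} f≡v = cong₂ _+_ (f≡v (here refl)) (∑-const (f≡v ∘ there))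

  ∑-≥-length-* : ∀ xs {f : A → ℕ} {v} → (∀ x → v ≤ f x) → length xs * v ≤ ∑ xs f
  ∑-≥-length-* xs {f} {v} v≤f = begin
    length xs * v    ≡⟨ sym (∑-const {xs} (λ _ → refl)) ⟩
    ∑[ _ ∈ xs ] v    ≤⟨ ∑-mono-≤ xs (λ {x} _ → v≤f x) ⟩
    ∑ xs f           ∎
    where open ≤-Reasoning

  ∑-+ : ∀ xs (f g : A → ℕ) → ∑[ x ∈ xs ] (f x + g x) ≡ ∑ xs f + ∑ xs g
  ∑-+ []       f g = refl
  ∑-+ (x ∷ xs) f g = trans (cong (f x + g x +_) (∑-+ xs f g)) (+-interchange (f x) (g x) _ _)

  ∑-* : ∀ k xs (f : A → ℕ) → ∑[ x ∈ xs ] (k * f x) ≡ k * ∑ xs f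
  ∑-* k []       f = sym (*-zeroʳ k)
  ∑-* k (x ∷ xs) f = trans (cong (k * f x +_) (∑-* k xs f)) (sym (*-distribˡ-+ k (f x) _))

  ∑-─ : ∀ {xs c} (c∈xs : c ∈ xs) (f : A → ℕ) → ∑ xs f ≡ f c + ∑ (xs ─ c∈xs) f
  ∑-─ (here refl)              f = refl
  ∑-─ {x ∷ xs} {c} (there c∈xs) f = trans (cong (f x +_) (∑-─ c∈xs f)) (+-left-comm (f x) (f c) _)

  ∑-mono-≤-excess : ∀ {xs c d} {f g : A → ℕ} → c ∈ xs →
    (∀ x → g x ≤ f x) → g c + d ≤ f c → ∑ xs g + d ≤ ∑ xs f
  ∑-mono-≤-excess {xs} {c} {d} {f} {g} c∈xs g≤f excess = begin
    ∑ xs g + d                              ≡⟨ cong (_+ d) (∑-─ c∈xs g) ⟩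
    g c + ∑ (xs ─ c∈xs) g + d               ≡⟨ +-right-comm (g c) _ d ⟩
    g c + d + ∑ (xs ─ c∈xs) g               ≤⟨ +-mono-≤ excess (∑-mono-≤ (xs ─ c∈xs) (λ {x} _ → g≤f x)) ⟩
    f c + ∑ (xs ─ c∈xs) f                   ≡⟨ sym (∑-─ c∈xs f) ⟩
    ∑ xs f                                  ∎
    where open ≤-Reasoning

  ∑-≥-member : ∀ {xs c} (f : A → ℕ) → c ∈ xs → f c ≤ ∑ xs f
  ∑-≥-member {xs} {c} f c∈xs = begin
    f c                       ≤⟨ m≤m+n (f c) _ ⟩
    f c + ∑ (xs ─ c∈xs) f     ≡⟨ sym (∑-─ c∈xs f) ⟩
    ∑ xs f                    ∎
    where open ≤-Reasoning

  ∈-─⁻ : ∀ {xs : List A} {c x} → Unique xs → (c∈xs : c ∈ xs) → x ∈ xs ─ c∈xs → x ∈ xs × x ≢ c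
  ∈-─⁻ (c∉xs ∷ _)  (here refl)  x∈xs          = there x∈xs , ≢-sym (All.lookup c∉xs x∈xs)
  ∈-─⁻ (z∉xs ∷ _)  (there c∈xs) (here refl)   = here refl , All.lookup z∉xs c∈xs
  ∈-─⁻ (_    ∷ u)  (there c∈xs) (there x∈xs─c) =
    let x∈xs , x≢c = ∈-─⁻ u c∈xs x∈xs─c in there x∈xs , x≢c

  ∑-one-exception : ∀ {xs : List A} {c v} (f : A → ℕ) → Unique xs → c ∈ xs →
    (∀ {x} → x ∈ xs → x ≢ c → f x ≡ v) → ∑ xs f ≡ f c + (length xs ∸ 1) * v
  ∑-one-exception {xs} {c} {v} f u c∈xs others = begin
    ∑ xs f                         ≡⟨ ∑-─ c∈xs f ⟩
    f c + ∑ (xs ─ c∈xs) f          ≡⟨ cong (f c +_) (∑-const {xs ─ c∈xs} (uncurry others ∘ ∈-─⁻ u c∈xs)) ⟩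
    f c + length (xs ─ c∈xs) * v   ≡⟨ cong (λ ℓ → f c + ℓ * v) |xs─c| ⟩
    f c + (length xs ∸ 1) * v      ∎
    where
    open ≡-Reasoning
    |xs─c| : length (xs ─ c∈xs) ≡ length xs ∸ 1
    |xs─c| = trans (length-removeAt xs (Any.index c∈xs)) (pred[m∸n]≡m∸[1+n] (length xs) 0)

  ∑-filter : ∀ {P : Pred A 0ℓ} (P? : Decidable P) xs (f : A → ℕ) →
    ∑ xs f ≡ ∑ (filter P? xs) f + ∑ (filter (∁? P?) xs) f
  ∑-filter P? []       f = refl
  ∑-filter P? (x ∷ xs) f with P? x
  ... | yes _ = trans (cong (f x +_) (∑-filter P? xs f)) (sym (+-assoc (f x) _ _))
  ... | no  _ = trans (cong (f x +_) (∑-filter P? xs f)) (+-left-comm (f x) (∑ (filter P? xs) f) _)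

∏-const : ∀ n v → ∏[ j < n ] v ≡ v ^ n
∏-const zero    v = refl
∏-const (suc n) v = cong (v *_) (∏-const n v)

∏-mono-≥ : ∀ n {v} {f : Fin n → ℕ} → (∀ j → v ≤ f j) → v ^ n ≤ ∏ n f
∏-mono-≥ zero    v≤f = ≤-refl
∏-mono-≥ (suc n) v≤f = *-mono-≤ (v≤f zero) (∏-mono-≥ n (v≤f ∘ suc))

⋀-cong : ∀ n {p q : Fin n → Bool} → (∀ j → p j ≡ q j) → ⋀ n p ≡ ⋀ n q
⋀-cong zero    p≗q = refl
⋀-cong (suc n) p≗q = cong₂ _∧_ (p≗q zero) (⋀-cong n (p≗q ∘ suc))

⋀-true : ∀ n → ⋀[ j < n ] true ≡ true
⋀-true zero    = refl
⋀-true (suc n) = ⋀-true n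

⋀-∧ : ∀ n (p q : Fin n → Bool) → ⋀[ j < n ] (p j ∧ q j) ≡ ⋀ n p ∧ ⋀ n q
⋀-∧ zero    p q = refl
⋀-∧ (suc n) p q with p zero | q zero
... | true  | true  = ⋀-∧ n (p ∘ suc) (q ∘ suc)
... | true  | false = sym (∧-zeroʳ (⋀ n (p ∘ suc)))
... | false | _     = refl

all-tabulate : ∀ {A : Set} n (p : A → Bool) (g : Fin n → A) → all p (tabulate g) ≡ ⋀[ j < n ] p (g j)
all-tabulate zero    p g = refl
all-tabulate (suc n) p g = cong (p (g zero) ∧_) (all-tabulate n p (g ∘ suc))

filterᵇ-cong : ∀ {A : Set} {p q : A → Bool} → (∀ x → p x ≡ q x) → ∀ xs → filterᵇ p xs ≡ filterᵇ q xs
filterᵇ-cong p≗q = filter-≐ _ _ ((λ {x} → subst T (p≗q x)) , (λ {x} → subst T (sym (p≗q x))))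

module _ {A B : Set} where

  count-map : ∀ (p : B → Bool) (g : A → B) xs →
    length (filterᵇ p (map g xs)) ≡ length (filterᵇ (p ∘ g) xs)
  count-map p g []       = refl
  count-map p g (x ∷ xs) with p (g x)
  ... | true  = cong suc (count-map p g xs)
  ... | false = count-map p g xs

  count-concatMap : ∀ (p : B → Bool) (f : A → List B) xs →
    length (filterᵇ p (concatMap f xs)) ≡ ∑[ x ∈ xs ] length (filterᵇ p (f x))
  count-concatMap p f []       = refl
  count-concatMap p f (x ∷ xs) = begin
    length (filterᵇ p (f x ++ concatMap f xs))                  ≡⟨ cong length (filter-++ _ (f x) _) ⟩
    length (filterᵇ p (f x) ++ filterᵇ p (concatMap f xs))      ≡⟨ length-++ (filterᵇ p (f x)) ⟩
    length (filterᵇ p (f x)) + length (filterᵇ p (concatMap f xs))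
      ≡⟨ cong (length (filterᵇ p (f x)) +_) (count-concatMap p f xs) ⟩
    ∑[ x ∈ x ∷ xs ] length (filterᵇ p (f x))                     ∎
    where open ≡-Reasoning

  ∑-count-∧ : ∀ (p : A → Bool) (q : B → Bool) xs ys →
    ∑[ x ∈ xs ] length (filterᵇ (λ y → p x ∧ q y) ys) ≡ length (filterᵇ p xs) * length (filterᵇ q ys)
  ∑-count-∧ p q []       ys = refl
  ∑-count-∧ p q (x ∷ xs) ys with p x
  ... | true  = cong (length (filterᵇ q ys) +_) (∑-count-∧ p q xs ys)
  ... | false = cong₂ _+_ (cong length (filter-none _ (All.universal (λ _ ()) ys))) (∑-count-∧ p q xs ys)

Unique-⊆⇒length-≤ : ∀ {xs ys : List ℕ} → Unique xs → (∀ {z} → z ∈ xs → z ∈ ys) → length xs ≤ length ys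
Unique-⊆⇒length-≤ {[]}     _           _      = z≤n
Unique-⊆⇒length-≤ {x ∷ xs} {ys} (x∉xs ∷ u) xs⊆ys = begin-strict
  length xs                ≤⟨ Unique-⊆⇒length-≤ u (λ z∈xs → ∈-filter⁺ ≢x? (xs⊆ys (there z∈xs)) (≢-sym (All.lookup x∉xs z∈xs))) ⟩
  length (filter ≢x? ys)   <⟨ filter-notAll ≢x? ys (Any.map (λ x≡z z≢x → z≢x (sym x≡z)) (xs⊆ys (here refl))) ⟩
  length ys                ∎
  where
  open ≤-Reasoning
  ≢x? : Decidable (_≢ x)
  ≢x? z = ¬? (z ≟ x)

length-<⇒∃∉ : ∀ {xs ys : List ℕ} → Unique xs → length ys < length xs → ∃[ x ] x ∈ xs × x ∉ ys
length-<⇒∃∉ {xs} {ys} u ys<xs with all? (_∈? ys) xs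
... | yes xs⊆ys  = contradiction (Unique-⊆⇒length-≤ u (All.lookup xs⊆ys)) (<⇒≱ ys<xs)
... | no  xs⊈ys  = find (¬All⇒Any¬ (_∈? ys) xs xs⊈ys)

≢-of-∉ : ∀ {x y : ℕ} {xs} → x ∉ xs → y ∈ xs → x ≢ y
≢-of-∉ x∉xs y∈xs refl = x∉xs y∈xs

module _ {P : Pred ℕ 0ℓ} (P? : Decidable P) where

  length-filter-+-∁ : ∀ xs → length (filter P? xs) + length (filter (∁? P?) xs) ≡ length xs
  length-filter-+-∁ []       = refl
  length-filter-+-∁ (x ∷ xs) with P? x
  ... | yes _ = cong suc (length-filter-+-∁ xs)
  ... | no  _ = trans (+-suc _ _) (cong suc (length-filter-+-∁ xs))

  length-≤-+-filter : ∀ {xs} D → Unique xs → (∀ {z} → z ∈ xs → ¬ P z → z ∈ D) →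
    length xs ≤ length D + length (filter P? xs)
  length-≤-+-filter {xs} D u rejected⊆D = begin
    length xs                                         ≡⟨ sym (length-filter-+-∁ xs) ⟩
    length (filter P? xs) + length (filter (∁? P?) xs) ≤⟨ +-monoʳ-≤ _ rejected≤D ⟩
    length (filter P? xs) + length D                  ≡⟨ +-comm _ (length D) ⟩
    length D + length (filter P? xs)                  ∎
    where
    open ≤-Reasoning
    rejected≤D : length (filter (∁? P?) xs) ≤ length D
    rejected≤D = Unique-⊆⇒length-≤ (Unique.filter⁺ (∁? P?) u) (uncurry rejected⊆D ∘ ∈-filter⁻ (∁? P?))

  length-+-filter-≤ : ∀ {xs} D → Unique D → (∀ {z} → z ∈ D → z ∈ xs × ¬ P z) →
    length D + length (filter P? xs) ≤ length xs
  length-+-filter-≤ {xs} D u D⊆rejected = begin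
    length D + length (filter P? xs)                  ≡⟨ +-comm (length D) _ ⟩
    length (filter P? xs) + length D                  ≤⟨ +-monoʳ-≤ _ D≤rejected ⟩
    length (filter P? xs) + length (filter (∁? P?) xs) ≡⟨ length-filter-+-∁ xs ⟩
    length xs                                         ∎
    where
    open ≤-Reasoning
    D≤rejected : length D ≤ length (filter (∁? P?) xs)
    D≤rejected = Unique-⊆⇒length-≤ u (uncurry (∈-filter⁺ (∁? P?)) ∘ D⊆rejected)

count-choices-suc : ∀ k (L : ListAssignment (suc k)) (p : Vec ℕ (suc k) → Bool) →
  length (filterᵇ p (choices (suc k) L))
    ≡ ∑[ c ∈ L zero ] length (filterᵇ (p ∘ (c ∷_)) (choices k (L ∘ suc)))
count-choices-suc k L p =
  trans (count-concatMap p _ (L zero)) (∑-cong (L zero) (λ c → count-map p (c ∷_) (choices k (L ∘ suc))))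

count-choices-⋀ : ∀ k (L : ListAssignment k) (P : Fin k → ℕ → Bool) →
  length (filterᵇ (λ f → ⋀[ j < k ] P j (lookup f j)) (choices k L))
    ≡ ∏[ j < k ] length (filterᵇ (P j) (L j))
count-choices-⋀ zero    L P = refl
count-choices-⋀ (suc k) L P = begin
  length (filterᵇ _ (choices (suc k) L))
    ≡⟨ count-choices-suc k L _ ⟩
  ∑[ c ∈ L zero ] length (filterᵇ (λ f → P zero c ∧ rest f) (choices k (L ∘ suc)))
    ≡⟨ ∑-count-∧ (P zero) rest (L zero) (choices k (L ∘ suc)) ⟩
  length (filterᵇ (P zero) (L zero)) * length (filterᵇ rest (choices k (L ∘ suc)))
    ≡⟨ cong (length (filterᵇ (P zero) (L zero)) *_) (count-choices-⋀ k (L ∘ suc) (P ∘ suc)) ⟩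
  ∏[ j < suc k ] length (filterᵇ (P j) (L j))
    ∎
  where
  open ≡-Reasoning
  rest : Vec ℕ k → Bool
  rest f = ⋀[ j < k ] P (suc j) (lookup f j)

avoids : ℕ → ℕ → ℕ → Bool
avoids c₁ c₂ c = not (c₁ ≡ᵇ c) ∧ not (c₂ ≡ᵇ c)

#avoiding : ℕ → ℕ → List ℕ → ℕ
#avoiding c₁ c₂ cs = length (filterᵇ (avoids c₁ c₂) cs)

≡ᵇ-sym : ∀ a b → (a ≡ᵇ b) ≡ (b ≡ᵇ a)
≡ᵇ-sym zero    zero    = refl
≡ᵇ-sym zero    (suc b) = refl
≡ᵇ-sym (suc a) zero    = refl
≡ᵇ-sym (suc a) (suc b) = ≡ᵇ-sym a b

isProper-K2 : ∀ n c₁ c₂ (f : Vec ℕ n) →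
  isProper (K2 n) (c₁ ∷ c₂ ∷ f) ≡ ⋀[ j < n ] avoids c₁ c₂ (lookup f j)
isProper-K2 n c₁ c₂ f = begin
  isProper (K2 n) F
    ≡⟨ all-tabulate (2 + n) (λ i → all (proper-at i) (allFin (2 + n))) id ⟩
  ⋀[ i < 2 + n ] all (proper-at i) (allFin (2 + n))
    ≡⟨ ⋀-cong (2 + n) (λ i → all-tabulate _ (proper-at i) id) ⟩
  ⋀[ i < 2 + n ] ⋀[ j < 2 + n ] proper-at i j
    -- row xₖ compares cₖ with every yⱼ; row yᵢ compares f i with c₁ and c₂ (then n vacuous entries)
    ≡⟨⟩
  A₁ ∧ (A₂ ∧ ⋀[ i < n ] (not (lookup f i ≡ᵇ c₁) ∧ (not (lookup f i ≡ᵇ c₂) ∧ ⋀[ _ < n ] true)))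
    ≡⟨ cong (λ b → A₁ ∧ (A₂ ∧ b)) (trans (⋀-cong n y-row) (⋀-∧ n _ _)) ⟩
  A₁ ∧ (A₂ ∧ (A₁ ∧ A₂))                               ≡⟨ ∧-idem-right A₁ A₂ ⟩
  A₁ ∧ A₂                                             ≡⟨ sym (⋀-∧ n _ _) ⟩
  ⋀[ j < n ] avoids c₁ c₂ (lookup f j)                ∎
  where
  open ≡-Reasoning
  F = c₁ ∷ c₂ ∷ f
  proper-at : Fin (2 + n) → Fin (2 + n) → Bool
  proper-at i j = not (adj (K2 n) i j) ∨ not (lookup F i ≡ᵇ lookup F j)
  A₁ A₂ : Bool
  A₁ = ⋀[ j < n ] not (c₁ ≡ᵇ lookup f j)
  A₂ = ⋀[ j < n ] not (c₂ ≡ᵇ lookup f j)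
  y-row : ∀ i → not (lookup f i ≡ᵇ c₁) ∧ (not (lookup f i ≡ᵇ c₂) ∧ ⋀[ _ < n ] true) ≡ avoids c₁ c₂ (lookup f i)
  y-row i rewrite ⋀-true n | ≡ᵇ-sym (lookup f i) c₁ | ≡ᵇ-sym (lookup f i) c₂ =
    cong (not (c₁ ≡ᵇ lookup f i) ∧_) (∧-identityʳ (not (c₂ ≡ᵇ lookup f i)))
  ∧-idem-right : ∀ a b → a ∧ (b ∧ (a ∧ b)) ≡ a ∧ b
  ∧-idem-right true  true  = refl
  ∧-idem-right true  false = refl
  ∧-idem-right false b     = refl

P-list-K2 : ∀ n (L : ListAssignment (2 + n)) →
  P-list (K2 n) L ≡ ∑[ c₁ ∈ L x₁ ] ∑[ c₂ ∈ L x₂ ] ∏[ j < n ] #avoiding c₁ c₂ (L (y j))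
P-list-K2 n L = begin
  P-list (K2 n) L
    ≡⟨ count-choices-suc (suc n) L _ ⟩
  ∑[ c₁ ∈ L x₁ ] length (filterᵇ (isProper (K2 n) ∘ (c₁ ∷_)) (choices (suc n) (L ∘ suc)))
    ≡⟨ ∑-cong (L x₁) (λ c₁ → count-choices-suc n (L ∘ suc) (isProper (K2 n) ∘ (c₁ ∷_))) ⟩
  ∑[ c₁ ∈ L x₁ ] ∑[ c₂ ∈ L x₂ ] length (filterᵇ (isProper (K2 n) ∘ (c₁ ∷_) ∘ (c₂ ∷_)) (choices n Ly))
    ≡⟨ ∑-cong (L x₁) (λ c₁ → ∑-cong (L x₂) (count-proper c₁)) ⟩
  ∑[ c₁ ∈ L x₁ ] ∑[ c₂ ∈ L x₂ ] ∏[ j < n ] #avoiding c₁ c₂ (L (y j))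
    ∎
  where
  open ≡-Reasoning
  Ly : ListAssignment n
  Ly j = L (y j)
  count-proper : ∀ c₁ c₂ → length (filterᵇ (isProper (K2 n) ∘ (c₁ ∷_) ∘ (c₂ ∷_)) (choices n Ly))
                             ≡ ∏[ j < n ] #avoiding c₁ c₂ (Ly j)
  count-proper c₁ c₂ = trans (cong length (filterᵇ-cong (isProper-K2 n c₁ c₂) (choices n Ly)))
                             (count-choices-⋀ n Ly (λ _ → avoids c₁ c₂))

avoids⁻ : ∀ c₁ c₂ c → ¬ T (avoids c₁ c₂ c) → c ≡ c₁ ⊎ c ≡ c₂
avoids⁻ c₁ c₂ c ¬avoids with c₁ ≡ᵇ c in c₁≡ᵇc
... | true  = inj₁ (sym (≡ᵇ⇒≡ c₁ c (subst T (sym c₁≡ᵇc) _)))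
... | false with c₂ ≡ᵇ c in c₂≡ᵇc
...   | true  = inj₂ (sym (≡ᵇ⇒≡ c₂ c (subst T (sym c₂≡ᵇc) _)))
...   | false = ⊥-elim (¬avoids _)

avoids-left : ∀ c₁ c₂ → ¬ T (avoids c₁ c₂ c₁)
avoids-left c₁ c₂ t with c₁ ≡ᵇ c₁ | ≡⇒≡ᵇ c₁ c₁ refl
... | true | _ = t

avoids-right : ∀ c₁ c₂ → ¬ T (avoids c₁ c₂ c₂)
avoids-right c₁ c₂ t with c₁ ≡ᵇ c₂ | c₂ ≡ᵇ c₂ | ≡⇒≡ᵇ c₂ c₂ refl
... | true  | _    | _ = t
... | false | true | _ = t

length-≤-+-#avoiding : ∀ {c₁ c₂ xs} D → Unique xs → (∀ {z} → z ∈ xs → z ≡ c₁ ⊎ z ≡ c₂ → z ∈ D) →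
  length xs ≤ length D + #avoiding c₁ c₂ xs
length-≤-+-#avoiding {c₁} {c₂} D u forbidden⊆D =
  length-≤-+-filter (T? ∘ avoids c₁ c₂) D u (λ z∈xs → forbidden⊆D z∈xs ∘ avoids⁻ c₁ c₂ _)

#avoiding-self : ∀ {c xs} → Unique xs → c ∈ xs → #avoiding c c xs ≡ length xs ∸ 1
#avoiding-self {c} {xs} u c∈xs = sym (trans (cong (_∸ 1) (sym 1+#≡length)) (m+n∸m≡n 1 _))
  where
  1+#≡length : 1 + #avoiding c c xs ≡ length xs
  1+#≡length = ≤-antisym
    (length-+-filter-≤ (T? ∘ avoids c c) (c ∷ []) ([] ∷ []) λ { (here refl) → c∈xs , avoids-left c c })
    (length-≤-+-#avoiding (c ∷ []) u (λ _ → [ here , here ]′))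

#avoiding-distinct : ∀ {c₁ c₂ xs} → Unique xs → c₁ ∈ xs → c₂ ∈ xs → c₁ ≢ c₂ →
  #avoiding c₁ c₂ xs ≡ length xs ∸ 2
#avoiding-distinct {c₁} {c₂} {xs} u c₁∈xs c₂∈xs c₁≢c₂ = sym (trans (cong (_∸ 2) (sym 2+#≡length)) (m+n∸m≡n 2 _))
  where
  2+#≡length : 2 + #avoiding c₁ c₂ xs ≡ length xs
  2+#≡length = ≤-antisym
    (length-+-filter-≤ (T? ∘ avoids c₁ c₂) (c₁ ∷ c₂ ∷ []) ((c₁≢c₂ ∷ []) ∷ [] ∷ [])
      λ { (here refl) → c₁∈xs , avoids-left c₁ c₂ ; (there (here refl)) → c₂∈xs , avoids-right c₁ c₂ })
    (length-≤-+-#avoiding (c₁ ∷ c₂ ∷ []) u (λ _ → [ here , there ∘ here ]′))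

P-list-K2-constant : ∀ n {cs} → Unique cs → let ℓ = length cs in
  P-list (K2 n) (λ _ → cs) ≡ ℓ * (ℓ ∸ 1) ^ n + ℓ * (ℓ ∸ 1) * (ℓ ∸ 2) ^ n
P-list-K2-constant n {cs} u = begin
  P-list (K2 n) (λ _ → cs)                               ≡⟨ P-list-K2 n (λ _ → cs) ⟩
  ∑[ c₁ ∈ cs ] ∑[ c₂ ∈ cs ] ∏[ j < n ] #avoiding c₁ c₂ cs ≡⟨ ∑-const row ⟩
  ℓ * ((ℓ ∸ 1) ^ n + (ℓ ∸ 1) * (ℓ ∸ 2) ^ n)              ≡⟨ *-distribˡ-+ ℓ _ _ ⟩
  ℓ * (ℓ ∸ 1) ^ n + ℓ * ((ℓ ∸ 1) * (ℓ ∸ 2) ^ n)          ≡⟨ cong (ℓ * (ℓ ∸ 1) ^ n +_) (sym (*-assoc ℓ _ _)) ⟩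
  ℓ * (ℓ ∸ 1) ^ n + ℓ * (ℓ ∸ 1) * (ℓ ∸ 2) ^ n            ∎
  where
  open ≡-Reasoning
  ℓ = length cs
  row : ∀ {c₁} → c₁ ∈ cs → ∑[ c₂ ∈ cs ] ∏[ j < n ] #avoiding c₁ c₂ cs ≡ (ℓ ∸ 1) ^ n + (ℓ ∸ 1) * (ℓ ∸ 2) ^ n
  row {c₁} c₁∈cs = begin
    ∑[ c₂ ∈ cs ] ∏[ j < n ] #avoiding c₁ c₂ cs
      ≡⟨ ∑-one-exception (λ c₂ → ∏[ j < n ] #avoiding c₁ c₂ cs) u c₁∈cs (λ c₂∈cs c₂≢c₁ →
           trans (∏-const n _) (cong (_^ n) (#avoiding-distinct u c₁∈cs c₂∈cs (≢-sym c₂≢c₁)))) ⟩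
    ∏[ j < n ] #avoiding c₁ c₁ cs + (ℓ ∸ 1) * (ℓ ∸ 2) ^ n
      ≡⟨ cong (_+ (ℓ ∸ 1) * (ℓ ∸ 2) ^ n) (trans (∏-const n _) (cong (_^ n) (#avoiding-self u c₁∈cs))) ⟩
    (ℓ ∸ 1) ^ n + (ℓ ∸ 1) * (ℓ ∸ 2) ^ n ∎

P-chrom-K2 : ∀ n m → P-chrom (K2 n) m ≡ m * (m ∸ 1) ^ n + m * (m ∸ 1) * (m ∸ 2) ^ n
P-chrom-K2 n m = trans (P-list-K2-constant n (Unique.upTo⁺ m))
  (cong (λ ℓ → ℓ * (ℓ ∸ 1) ^ n + ℓ * (ℓ ∸ 1) * (ℓ ∸ 2) ^ n) (length-upTo m))

∑∏-lower-bound : ∀ n k (A : List ℕ) (β : ℕ → Fin n → ℕ) (α : Fin n → ℕ) →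
  length A ≡ suc k → (∀ c j → suc k ≤ β c j) → (∀ j → k ≤ α j) →
  (∀ j → suc k ≤ α j ⊎ ∃[ c ] c ∈ A × 2 + k ≤ β c j) →
  (2 + k) * suc k ^ n ≤ ∑[ c ∈ A ] ∏ n (β c) + ∏ n α
∑∏-lower-bound zero k A β α |A| _ _ _ = ≤-reflexive (begin
  (2 + k) * 1              ≡⟨ +-comm 1 (suc k * 1) ⟩
  suc k * 1 + 1            ≡⟨ cong (λ ℓ → ℓ * 1 + 1) (sym |A|) ⟩
  length A * 1 + 1         ≡⟨ cong (_+ 1) (sym (∑-const {xs = A} (λ _ → refl))) ⟩
  ∑[ _ ∈ A ] 1 + 1         ∎)
  where open ≡-Reasoning
∑∏-lower-bound (suc n) k A β α |A| β≥ α≥ column = [ α₀-large , β₀-large ]′ (column zero)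
  where
  open ≤-Reasoning
  K X′ Y′ : ℕ
  K = suc k ^ n
  h : ℕ → ℕ
  h c = ∏ n (β c ∘ suc)
  X′ = ∑ A h
  Y′ = ∏ n (α ∘ suc)
  X : ℕ
  X = ∑[ c ∈ A ] ∏ (suc n) (β c)

  IH : (2 + k) * K ≤ X′ + Y′
  IH = ∑∏-lower-bound n k A (λ c → β c ∘ suc) (α ∘ suc) |A| (λ c → β≥ c ∘ suc) (α≥ ∘ suc) (column ∘ suc)

  X≥ : suc k * X′ ≤ X
  X≥ = subst (_≤ X) (∑-* (suc k) A h) (∑-mono-≤ A (λ {c} _ → *-monoˡ-≤ (h c) (β≥ c zero)))

  α₀-large : suc k ≤ α zero → (2 + k) * (suc k * K) ≤ X + α zero * Y′
  α₀-large α₀≥ = begin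
    (2 + k) * (suc k * K)           ≡⟨ *-left-comm (2 + k) (suc k) K ⟩
    suc k * ((2 + k) * K)           ≤⟨ *-monoʳ-≤ (suc k) IH ⟩
    suc k * (X′ + Y′)               ≡⟨ *-distribˡ-+ (suc k) X′ Y′ ⟩
    suc k * X′ + suc k * Y′         ≤⟨ +-mono-≤ X≥ (*-monoˡ-≤ Y′ α₀≥) ⟩
    X + α zero * Y′                 ∎

  -- row c₀ contributes an extra h c₀ ≥ K in column 0, making up for α₀ being only ≥ k
  β₀-large : ∃[ c ] c ∈ A × 2 + k ≤ β c zero → (2 + k) * (suc k * K) ≤ X + α zero * Y′
  β₀-large (c₀ , c₀∈A , β₀≥) = begin
    (2 + k) * (suc k * K)                  ≡⟨ regroup k K ⟩
    suc k * K + k * ((2 + k) * K) + K      ≤⟨ +-mono-≤ (+-mono-≤ X′≥ (*-monoʳ-≤ k IH)) (∏-mono-≥ n (β≥ c₀ ∘ suc)) ⟩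
    X′ + k * (X′ + Y′) + h c₀              ≡⟨ regroup′ k X′ Y′ (h c₀) ⟩
    (suc k * X′ + h c₀) + k * Y′           ≤⟨ +-mono-≤ X≥⁺ (*-monoˡ-≤ Y′ (α≥ zero)) ⟩
    X + α zero * Y′                        ∎
    where
    regroup : ∀ k K → (2 + k) * (suc k * K) ≡ suc k * K + k * ((2 + k) * K) + K
    regroup = solve-∀
    regroup′ : ∀ k X Y Z → X + k * (X + Y) + Z ≡ (suc k * X + Z) + k * Y
    regroup′ = solve-∀
    X′≥ : suc k * K ≤ X′
    X′≥ = subst (λ ℓ → ℓ * K ≤ X′) |A| (∑-≥-length-* A (λ c → ∏-mono-≥ n (β≥ c ∘ suc)))
    X≥⁺ : suc k * X′ + h c₀ ≤ X
    X≥⁺ = subst (λ S → S + h c₀ ≤ X) (∑-* (suc k) A h)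
      (∑-mono-≤-excess c₀∈A (λ c → *-monoˡ-≤ (h c) (β≥ c zero))
        (subst (_≤ β c₀ zero * h c₀) (+-comm (h c₀) _) (*-monoˡ-≤ (h c₀) β₀≥)))

module _ (n k : ℕ) (L : ListAssignment (2 + n))
         (unique : ∀ v → Unique (L v)) (lengths : ∀ v → length (L v) ≡ 2 + k)
         (shared : length (filter (_∈? L x₂) (L x₁)) ≡ suc k) where

  private
    L₁ L₂ A : List ℕ
    L₁ = L x₁
    L₂ = L x₂
    A = filter (_∈? L₂) L₁

    Ly : Fin n → List ℕ
    Ly j = L (y j)

    private-colour : ∀ {L L′} → Unique L → length L ≡ 2 + k →
      (∀ {c} → c ∈ L → c ∈ L′ → c ∈ A) → ∃[ a ] a ∈ L × a ∉ L′
    private-colour u |L| L∩L′⊆A with length-<⇒∃∉ u (≤-reflexive (trans (cong suc shared) (sym |L|)))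
    ... | a , a∈L , a∉A = a , a∈L , a∉A ∘ L∩L′⊆A a∈L

    #avoiding-≥ : ∀ j {c₁ c₂} D {r} → length D + r ≡ 2 + k →
      (∀ {z} → z ∈ Ly j → z ≡ c₁ ⊎ z ≡ c₂ → z ∈ D) → r ≤ #avoiding c₁ c₂ (Ly j)
    #avoiding-≥ j {c₁} {c₂} D {r} D+r forbidden⊆D = +-cancelˡ-≤ (length D) r _
      (subst (_≤ length D + #avoiding c₁ c₂ (Ly j)) (trans (lengths (y j)) (sym D+r))
        (length-≤-+-#avoiding D (unique (y j)) forbidden⊆D))

    avoid-any : ∀ j c₁ c₂ → k ≤ #avoiding c₁ c₂ (Ly j)
    avoid-any j c₁ c₂ = #avoiding-≥ j (c₁ ∷ c₂ ∷ []) refl (λ _ → [ here , there ∘ here ]′)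

    avoid-same : ∀ j c → suc k ≤ #avoiding c c (Ly j)
    avoid-same j c = #avoiding-≥ j (c ∷ []) refl (λ _ → [ here , here ]′)

    term : ℕ → ℕ → ℕ
    term c₁ c₂ = ∏[ j < n ] #avoiding c₁ c₂ (Ly j)

    row : ℕ → ℕ
    row c₁ = ∑ L₂ (term c₁)

    others : ℕ
    others = suc k * k ^ n

    row-≥ : ∀ c₁ {c₂} → c₂ ∈ L₂ → term c₁ c₂ + others ≤ row c₁
    row-≥ c₁ {c₂} c₂∈L₂ = begin
      term c₁ c₂ + suc k * k ^ n                 ≡⟨ cong (λ ℓ → term c₁ c₂ + ℓ * k ^ n) |L₂─c₂| ⟩
      term c₁ c₂ + length (L₂ ─ c₂∈L₂) * k ^ n   ≤⟨ +-monoʳ-≤ (term c₁ c₂) (∑-≥-length-* (L₂ ─ c₂∈L₂) term-≥) ⟩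
      term c₁ c₂ + ∑ (L₂ ─ c₂∈L₂) (term c₁)      ≡⟨ sym (∑-─ c₂∈L₂ (term c₁)) ⟩
      row c₁                                     ∎
      where
      open ≤-Reasoning
      term-≥ : ∀ c → k ^ n ≤ term c₁ c
      term-≥ c = ∏-mono-≥ n (λ j → avoid-any j c₁ c)
      |L₂─c₂| : suc k ≡ length (L₂ ─ c₂∈L₂)
      |L₂─c₂| = suc-injective (trans (sym (lengths x₂)) (length-removeAt′ L₂ (Any.index c₂∈L₂)))

    module _ {a b} (a∈L₁ : a ∈ L₁) (a∉L₂ : a ∉ L₂) (b∈L₂ : b ∈ L₂) (b∉L₁ : b ∉ L₁) where

      distinct : Unique (a ∷ b ∷ A)
      distinct = (≢-of-∉ a∉L₂ b∈L₂ ∷ All.tabulate (≢-of-∉ a∉L₂ ∘ proj₂ ∘ ∈-filter⁻ (_∈? L₂) {xs = L₁}))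
               ∷ All.tabulate (≢-of-∉ b∉L₁ ∘ proj₁ ∘ ∈-filter⁻ (_∈? L₂) {xs = L₁})
               ∷ Unique.filter⁺ (_∈? L₂) (unique x₁)

      column : ∀ j → suc k ≤ #avoiding a b (Ly j) ⊎ ∃[ c ] c ∈ A × 2 + k ≤ #avoiding c c (Ly j)
      column j with length-<⇒∃∉ distinct (≤-reflexive (cong suc (trans (lengths (y j)) (cong suc (sym shared)))))
      ... | _ , here refl , a∉ = inj₁ (#avoiding-≥ j (b ∷ []) refl (λ z∈ → [ ⊥-elim ∘ ≢-of-∉ a∉ z∈ ∘ sym , here ]′))
      ... | _ , there (here refl) , b∉ = inj₁ (#avoiding-≥ j (a ∷ []) refl (λ z∈ → [ here , ⊥-elim ∘ ≢-of-∉ b∉ z∈ ∘ sym ]′))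
      ... | c , there (there c∈A) , c∉ = inj₂ (c , c∈A , #avoiding-≥ j [] refl (λ z∈ → [ absurd z∈ , absurd z∈ ]′))
        where
        absurd : ∀ {z} → z ∈ Ly j → z ≡ c → z ∈ []
        absurd z∈ = ⊥-elim ∘ ≢-of-∉ c∉ z∈ ∘ sym

      diagonal-≥ : (2 + k) * suc k ^ n ≤ ∑[ c ∈ A ] term c c + term a b
      diagonal-≥ = ∑∏-lower-bound n k A (λ c j → #avoiding c c (Ly j)) (λ j → #avoiding a b (Ly j)) shared
        (λ c j → avoid-same j c) (λ j → avoid-any j a b) column

      kept-terms : ∑[ c ∈ A ] (term c c + others) ≡ ∑[ c ∈ A ] term c c + suc k * others
      kept-terms = trans (∑-+ A (λ c → term c c) (λ _ → others))
        (cong (∑[ c ∈ A ] term c c +_) (trans (∑-const {xs = A} (λ _ → refl)) (cong (_* others) shared)))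

      P-list-≥ : (2 + k) * suc k ^ n + (2 + k) * suc k * k ^ n ≤ P-list (K2 n) L
      P-list-≥ = begin
        (2 + k) * suc k ^ n + (2 + k) * suc k * k ^ n           ≡⟨ cong ((2 + k) * suc k ^ n +_) (split k (k ^ n)) ⟩
        (2 + k) * suc k ^ n + (suc k * others + others)          ≤⟨ +-monoˡ-≤ _ diagonal-≥ ⟩
        ∑[ c ∈ A ] term c c + term a b + (suc k * others + others)
          ≡⟨ +-interchange (∑[ c ∈ A ] term c c) (term a b) (suc k * others) others ⟩
        ∑[ c ∈ A ] term c c + suc k * others + (term a b + others) ≡⟨ cong (_+ (term a b + others)) (sym kept-terms) ⟩
        ∑[ c ∈ A ] (term c c + others) + (term a b + others)
          ≤⟨ +-mono-≤ (∑-mono-≤ A (λ {c} c∈A → row-≥ c (proj₂ (∈-filter⁻ (_∈? L₂) {xs = L₁} c∈A)))) (row-≥ a b∈L₂) ⟩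
        ∑ A row + row a                                          ≤⟨ +-monoʳ-≤ (∑ A row) (∑-≥-member row (∈-filter⁺ (∁? (_∈? L₂)) a∈L₁ a∉L₂)) ⟩
        ∑ A row + ∑ (filter (∁? (_∈? L₂)) L₁) row                ≡⟨ sym (∑-filter (_∈? L₂) L₁ row) ⟩
        ∑ L₁ row                                                 ≡⟨ sym (P-list-K2 n L) ⟩
        P-list (K2 n) L                                          ∎
        where
        open ≤-Reasoning
        split : ∀ k K → (2 + k) * suc k * K ≡ suc k * (suc k * K) + suc k * K
        split = solve-∀

  P-list-K2-≥ : (2 + k) * suc k ^ n + (2 + k) * suc k * k ^ n ≤ P-list (K2 n) L
  P-list-K2-≥ with private-colour (unique x₁) (lengths x₁) (∈-filter⁺ (_∈? L₂))
                 | private-colour (unique x₂) (lengths x₂) (λ c∈L₂ c∈L₁ → ∈-filter⁺ (_∈? L₂) c∈L₁ c∈L₂)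
  ... | a , a∈L₁ , a∉L₂ | b , b∈L₂ , b∉L₁ = P-list-≥ a∈L₁ a∉L₂ b∈L₂ b∉L₁

lemma6 : (n m : ℕ) → n ≥ 3 → m ≥ 3 → (L : ListAssignment (2 + n)) →
    (∀ v → Unique (L v)) → (∀ v → length (L v) ≡ m) →
    length (filter (_∈? L x₂) (L x₁)) ≡ m ∸ 1 →
    (∀ (j : Fin n) c → c ∈ L (y j) → c ∈ L x₁ ⊎ c ∈ L x₂) →
    (P-list (K2 n) L ≥ P-chrom (K2 n) m)
      × (P-chrom (K2 n) m ≡ m * (m ∸ 1) ^ n + m * (m ∸ 1) * (m ∸ 2) ^ n)
lemma6 n m@(suc (suc k)) _ (s≤s (s≤s _)) L unique lengths shared _ =
  ≤-trans (≤-reflexive (P-chrom-K2 n m)) (P-list-K2-≥ n k L unique lengths shared) , P-chrom-K2 n m
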